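{- For every odd $n\geq 3$ and every $m\geq 2$, the generalized open web $OW_{m,n}$ is harmonious, i.e. $Z_{(2m-1)n}$-harmonious.
   Context: The generalized prism $Y_{m,n}$ is the Cartesian product $P_m\Box C_n$ (layers $C^1,\dots,C^m$ of $C_n$ with corresponding vertices of consecutive layers adjacent). The generalized closed web $CW_{m,n}$ is obtained from $Y_{m,n}$ by adding one new vertex joined to every vertex of the top cycle $C^1$; the generalized open web $OW_{m,n}$ is obtained from $CW_{m,n}$ by deleting the edges of the bottom cycle $C^m$, and has $(2m-1)n$ edges. A graph $G=(V,E)$ with $q$ edges is harmonious if there is an injection $f:V\to Z_q$ such that the induced edge labels $w(xy)=f(x)+f(y)\bmod q$ form a bijection $E\to Z_q$. -}

module Defs where

open import Data.Nat using (ℕ; zero; suc; _+_; _<?_)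
open import Data.Nat.DivMod using (_mod_)
open import Data.Fin using (Fin; zero; suc; toℕ; fromℕ<; inject₁)
open import Data.Maybe using (Maybe; just; nothing)
open import Data.Product using (Σ; _×_; _,_)
open import Relation.Nullary using (yes; no)
open import Relation.Binary.PropositionalEquality using (_≡_)
open import Function.Definitions using (Injective; Bijective)

record Graph : Set₁ where
  field
    V    : Set
    E    : Set
    ends : E → V × V

-- addition in Z_q (= Fin q); Fin 0 is empty so q = 0 needs no case
_+ₘ_ : ∀ {q} → Fin q → Fin q → Fin q
_+ₘ_ {suc q} a b = (toℕ a + toℕ b) mod suc q

edgeLabel : (G : Graph) → ∀ {q} → (Graph.V G → Fin q) → Graph.E G → Fin q
edgeLabel G f e with Graph.ends G e
... | (x , y) = f x +ₘ f y

Harmonious : Graph → ℕ → Set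
Harmonious G q =
  Σ (Graph.V G → Fin q) λ f →
    Injective _≡_ _≡_ f × Bijective _≡_ _≡_ (edgeLabel G f)

csuc : ∀ {n} → Fin n → Fin n
csuc {suc n} j with suc (toℕ j) <? suc n
... | yes p = fromℕ< p
... | no _  = zero

-- Vertices of OW_{m,n}: the apex (nothing) and (i , j) = vertex j of layer C^{i+1},
-- with layers indexed 0..m-1 (layer 0 = top cycle C^1, layer m-1 = bottom C^m).
OWVertex : ℕ → ℕ → Set
OWVertex m n = Maybe (Fin m × Fin n)

-- Edges of OW_{m,n}; the index m is written suc k (k = m - 1):
--   spoke j   : apex — (0 , j)                          (n edges)
--   cyc i j   : (i , j) — (i , j+1 mod n), i < m-1       ((m-1)n edges; bottom cycle removed)
--   rung i j  : (i , j) — (i+1 , j),       i < m-1       ((m-1)n edges)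
data OWEdge : ℕ → ℕ → Set where
  spoke : ∀ {k n} → Fin n → OWEdge (suc k) n
  cyc   : ∀ {k n} → Fin k → Fin n → OWEdge (suc k) n
  rung  : ∀ {k n} → Fin k → Fin n → OWEdge (suc k) n

owEnds : ∀ {m n} → OWEdge m n → OWVertex m n × OWVertex m n
owEnds (spoke j)  = nothing , just (zero , j)
owEnds (cyc i j)  = just (inject₁ i , j) , just (inject₁ i , csuc j)
owEnds (rung i j) = just (inject₁ i , j) , just (suc i , j)

OW : ℕ → ℕ → Graph
OW m n = record { V = OWVertex m n ; E = OWEdge m n ; ends = owEnds }

{-# OPTIONS --safe #-}
module Submission where

-- Put M = 2m − 1, so that q = M·n, and read labels as numerals a·M + r with low digit r < M.
-- Vertex j of layer i is labelled j·M + i and the apex 0·M + 2(m − 1).  The low digits of the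
-- two ends of an edge sum to less than M, so adding labels modulo q adds low digits exactly
-- and high digits modulo n.  The low digit of an edge label is 2(m − 1) for a spoke, 2i for
-- a cycle edge of layer i and 2i + 1 for a rung between layers i and i + 1, which identifies
-- the kind and layer of the edge; the high digit is j, 2j + 1 or 2j (mod n) respectively, and
-- since n is odd these maps are bijections of Z_n.

open import Defs
open import Data.Nat using (ℕ; zero; suc; _+_; _*_; _∸_; _≤_; _<_; _≟_; _<?_; z≤n; s≤s; s≤s⁻¹; NonZero; _%_; _/_; >-nonZero⁻¹)
open import Data.Nat.Properties
open import Data.Nat.DivMod
open import Data.Nat.Tactic.RingSolver using (solve)
open import Data.Fin using (Fin; toℕ; fromℕ<; inject₁) renaming (zero to fzero; suc to fsuc)
open import Data.Fin.Properties using (toℕ-fromℕ<; toℕ-inject₁; toℕ-injective; toℕ<n)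
open import Data.List using (_∷_; [])
open import Data.Maybe using (just; nothing)
open import Data.Product using (∃; Σ; _×_; _,_; uncurry)
open import Data.Sum using (_⊎_; inj₁; inj₂; [_,_])
open import Function.Definitions using (Injective; Surjective)
open import Relation.Binary.PropositionalEquality using (_≡_; _≢_; refl; sym; trans; cong; cong₂; subst; subst₂; module ≡-Reasoning)
open import Relation.Nullary using (yes; no)
open import Relation.Nullary.Negation using (contradiction)

even⊎odd : ∀ x → (∃ λ t → x ≡ 2 * t) ⊎ (∃ λ t → x ≡ suc (2 * t))
even⊎odd zero = inj₁ (0 , refl)
even⊎odd (suc x) with even⊎odd x
... | inj₁ (t , refl) = inj₂ (t , refl)
... | inj₂ (t , refl) = inj₁ (suc t , sym (*-suc 2 t))

m<2n⇒m≡m%n⊎m≡m%n+n : ∀ {m n} .{{_ : NonZero n}} → m < 2 * n → m ≡ m % n ⊎ m ≡ m % n + n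
m<2n⇒m≡m%n⊎m≡m%n+n {m} {n} m<2n with m / n | m≡m%n+[m/n]*n m n | m<n*o⇒m/o<n {m} {2} {n} m<2n
... | 0 | m≡ | _ = inj₁ (trans m≡ (+-identityʳ (m % n)))
... | 1 | m≡ | _ = inj₂ (trans m≡ (cong (m % n +_) (+-identityʳ n)))
... | suc (suc _) | _ | s≤s (s≤s ())

m+m≡2*m : ∀ m → m + m ≡ 2 * m
m+m≡2*m m = cong (m +_) (sym (+-identityʳ m))

m+1+m≡1+2*m : ∀ m → m + suc m ≡ 1 + 2 * m
m+1+m≡1+2*m m = trans (+-suc m m) (cong suc (m+m≡2*m m))

toℕ-csuc : ∀ {n} (j : Fin (suc n)) → toℕ (csuc j) ≡ suc (toℕ j) % suc n
toℕ-csuc {n} j with suc (toℕ j) <? suc n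
... | yes j+1<n = trans (toℕ-fromℕ< j+1<n) (sym (m<n⇒m%n≡m j+1<n))
... | no j+1≮n = sym (trans (%-congˡ {o = suc n} (cong suc j≡n)) (n%n≡0 (suc n)))
  where
  j≡n : toℕ j ≡ n
  j≡n = ≤-antisym (s≤s⁻¹ (toℕ<n j)) (s≤s⁻¹ (≮⇒≥ j+1≮n))

toℕ+toℕ-csuc : ∀ {n} (j : Fin (suc n)) → (toℕ j + toℕ (csuc j)) % suc n ≡ (1 + 2 * toℕ j) % suc n
toℕ+toℕ-csuc {n} j = begin
  (x + toℕ (csuc j)) % suc n         ≡⟨ %-congˡ (cong (x +_) (toℕ-csuc j)) ⟩
  (x + suc x % suc n) % suc n        ≡⟨ %-distribˡ-+ x (suc x % suc n) (suc n) ⟩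
  (x % suc n + suc x % suc n % suc n) % suc n
                                     ≡⟨ %-congˡ (cong (x % suc n +_) (m%n%n≡m%n (suc x) (suc n))) ⟩
  (x % suc n + suc x % suc n) % suc n ≡⟨ %-distribˡ-+ x (suc x) (suc n) ⟨
  (x + suc x) % suc n                ≡⟨ %-congˡ (m+1+m≡1+2*m x) ⟩
  (1 + 2 * x) % suc n                ∎
  where
  open ≡-Reasoning
  x = toℕ j

module _ {M : ℕ} where

  numeral-< : ∀ {a r n} → a < n → r < M → a * M + r < M * n
  numeral-< {a} {r} {n} a<n r<M = begin-strict
    a * M + r <⟨ +-monoʳ-< (a * M) r<M ⟩
    a * M + M ≡⟨ +-comm (a * M) M ⟩
    suc a * M ≤⟨ *-monoˡ-≤ M a<n ⟩
    n * M     ≡⟨ *-comm n M ⟩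
    M * n     ∎
    where open ≤-Reasoning

  numeral-+ : ∀ a r b s → (a * M + r) + (b * M + s) ≡ (a + b) * M + (r + s)
  numeral-+ a r b s = solve (a ∷ r ∷ b ∷ s ∷ M ∷ [])

  numeral-injective : ∀ {a b r s} .{{_ : NonZero M}} → r < M → s < M →
                      a * M + r ≡ b * M + s → a ≡ b × r ≡ s
  numeral-injective {a} {b} {r} {s} r<M s<M eq = a≡b , r≡s
    where
    low-digit : ∀ {a r} → r < M → (a * M + r) % M ≡ r
    low-digit {a} {r} r<M =
      trans (%-congˡ (+-comm (a * M) r)) (trans ([m+kn]%n≡m%n r a M) (m<n⇒m%n≡m r<M))
    r≡s : r ≡ s
    r≡s = trans (sym (low-digit {a} r<M)) (trans (%-congˡ eq) (low-digit {b} s<M))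
    a≡b : a ≡ b
    a≡b = *-cancelʳ-≡ a b M (+-cancelʳ-≡ r _ _ (trans eq (cong (b * M +_) (sym r≡s))))

  numeral-% : ∀ a {r} n .{{_ : NonZero M}} .{{_ : NonZero n}} .{{_ : NonZero (M * n)}} → r < M →
              (a * M + r) % (M * n) ≡ a % n * M + r
  numeral-% a {r} n r<M = begin
    (a * M + r) % (M * n)       ≡⟨ %-congʳ (*-comm M n) ⟩
    (a * M + r) % (n * M)       ≡⟨ [m*n+o]%[p*n]≡[m*n]%[p*n]+o a n r<M ⟩
    (a * M) % (n * M) + r       ≡⟨ cong (_+ r) (m%n*o≡m*o%[n*o] a n M) ⟨
    a % n * M + r               ∎
    where
    open ≡-Reasoning
    instance _ = m*n≢0 n M

module Doubling (h : ℕ) where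

  n : ℕ
  n = suc (2 * h)

  private
    c+2j<2n : ∀ {c j} → c ≤ 1 → j < n → c + 2 * j < 2 * n
    c+2j<2n {c} {j} c≤1 j<n = begin-strict
      c + 2 * j ≤⟨ +-monoˡ-≤ (2 * j) c≤1 ⟩
      1 + 2 * j <⟨ n<1+n _ ⟩
      2 + 2 * j ≡⟨ *-suc 2 j ⟨
      2 * suc j ≤⟨ *-monoʳ-≤ 2 j<n ⟩
      2 * n     ∎
      where open ≤-Reasoning

    c+2j-injective : ∀ c {j j'} → c + 2 * toℕ {n} j ≡ c + 2 * toℕ j' → j ≡ j'
    c+2j-injective c e = toℕ-injective (*-cancelˡ-≡ _ _ 2 (+-cancelˡ-≡ c _ _ e))

    -- the two sides have different parities because n is odd
    parity-clash : ∀ c j j' → c + 2 * j' ≢ (c + 2 * j) + n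
    parity-clash c j j' eq = even≢odd j' (j + h) (+-cancelˡ-≡ c _ _ (trans eq regroup))
      where
      regroup : (c + 2 * j) + suc (2 * h) ≡ c + suc (2 * (j + h))
      regroup = solve (c ∷ j ∷ h ∷ [])

  doubling-injective : ∀ {c} → c ≤ 1 → (j j' : Fin n) →
                       (c + 2 * toℕ j) % n ≡ (c + 2 * toℕ j') % n → j ≡ j'
  doubling-injective {c} c≤1 j j' eq
    with m<2n⇒m≡m%n⊎m≡m%n+n (c+2j<2n c≤1 (toℕ<n j)) | m<2n⇒m≡m%n⊎m≡m%n+n (c+2j<2n c≤1 (toℕ<n j'))
  ... | inj₁ x≡ | inj₁ y≡ = c+2j-injective c (trans x≡ (trans eq (sym y≡)))
  ... | inj₂ x≡ | inj₂ y≡ = c+2j-injective c (trans x≡ (trans (cong (_+ n) eq) (sym y≡)))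
  ... | inj₁ x≡ | inj₂ y≡ =
    contradiction (trans y≡ (cong (_+ n) (trans (sym eq) (sym x≡)))) (parity-clash c (toℕ j) (toℕ j'))
  ... | inj₂ x≡ | inj₁ y≡ =
    contradiction (trans x≡ (cong (_+ n) (trans eq (sym y≡)))) (parity-clash c (toℕ j') (toℕ j))

  private
    halve : ∀ {c} a → c ≤ 1 → ∃ λ j → c + 2 * j ≡ a ⊎ c + 2 * j ≡ a + n
    halve a z≤n with even⊎odd a
    ... | inj₁ (u , refl) = u , inj₁ refl
    ... | inj₂ (u , refl) = suc (u + h) , inj₂ regroup
      where
      regroup : 2 * suc (u + h) ≡ suc (2 * u) + suc (2 * h)
      regroup = solve (u ∷ h ∷ [])
    halve a (s≤s z≤n) with even⊎odd a
    ... | inj₁ (u , refl) = u + h , inj₂ regroup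
      where
      regroup : 1 + 2 * (u + h) ≡ 2 * u + suc (2 * h)
      regroup = solve (u ∷ h ∷ [])
    ... | inj₂ (u , refl) = u , inj₁ refl

  doubling-surjective : ∀ {c a} → c ≤ 1 → a < n → ∃ λ (j : Fin n) → (c + 2 * toℕ j) % n ≡ a
  doubling-surjective {c} {a} c≤1 a<n with halve a c≤1
  ... | j , c+2j≡ =
    fromℕ< j<n , trans (cong (λ x → (c + 2 * x) % n) (toℕ-fromℕ< j<n)) (≡a⊎≡a+n⇒%n≡a c+2j≡)
    where
    c+2j≤a+n : c + 2 * j ≤ a + n
    c+2j≤a+n = [ (λ e → ≤-trans (≤-reflexive e) (m≤m+n a n)) , ≤-reflexive ] c+2j≡
    j<n : j < n
    j<n = *-cancelˡ-< 2 j n (begin-strict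
      2 * j     ≤⟨ m≤n+m (2 * j) c ⟩
      c + 2 * j ≤⟨ c+2j≤a+n ⟩
      a + n     <⟨ +-monoˡ-< n a<n ⟩
      n + n     ≡⟨ cong (n +_) (+-identityʳ n) ⟨
      2 * n     ∎)
      where open ≤-Reasoning
    ≡a⊎≡a+n⇒%n≡a : ∀ {x} → x ≡ a ⊎ x ≡ a + n → x % n ≡ a
    ≡a⊎≡a+n⇒%n≡a (inj₁ refl) = m<n⇒m%n≡m a<n
    ≡a⊎≡a+n⇒%n≡a (inj₂ refl) = trans ([m+n]%n≡m%n a n) (m<n⇒m%n≡m a<n)

module OpenWebLabelling (k h : ℕ) .{{_ : NonZero k}} where

  open Doubling h

  m M q : ℕ
  m = suc k
  M = suc (2 * k)
  q = M * n

  vertexHigh : OWVertex m n → ℕ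
  vertexHigh nothing        = 0
  vertexHigh (just (i , j)) = toℕ j

  vertexLow : OWVertex m n → ℕ
  vertexLow nothing        = 2 * k
  vertexLow (just (i , j)) = toℕ i

  layer<2k : (i : Fin m) → toℕ i < 2 * k
  layer<2k i = <-≤-trans (toℕ<n i) (begin
    1 + k     ≤⟨ +-monoˡ-≤ k (>-nonZero⁻¹ k) ⟩
    k + k     ≡⟨ cong (k +_) (+-identityʳ k) ⟨
    2 * k     ∎)
    where open ≤-Reasoning

  vertexHigh<n : ∀ v → vertexHigh v < n
  vertexHigh<n nothing        = s≤s z≤n
  vertexHigh<n (just (i , j)) = toℕ<n j

  vertexLow<M : ∀ v → vertexLow v < M
  vertexLow<M nothing        = n<1+n (2 * k)
  vertexLow<M (just (i , j)) = m<n⇒m<1+n (layer<2k i)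

  label : OWVertex m n → Fin q
  label v = fromℕ< (numeral-< (vertexHigh<n v) (vertexLow<M v))

  toℕ-label : ∀ v → toℕ (label v) ≡ vertexHigh v * M + vertexLow v
  toℕ-label v = toℕ-fromℕ< _

  vertexDigits-injective : ∀ v w → vertexHigh v ≡ vertexHigh w → vertexLow v ≡ vertexLow w → v ≡ w
  vertexDigits-injective nothing        nothing          _   _   = refl
  vertexDigits-injective nothing        (just (i , _))   _   2k≡i = contradiction (sym 2k≡i) (<⇒≢ (layer<2k i))
  vertexDigits-injective (just (i , _)) nothing          _   i≡2k = contradiction i≡2k (<⇒≢ (layer<2k i))
  vertexDigits-injective (just (i , j)) (just (i' , j')) j≡j' i≡i' =
    cong just (cong₂ _,_ (toℕ-injective i≡i') (toℕ-injective j≡j'))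

  label-injective : Injective _≡_ _≡_ label
  label-injective {v} {w} eq = uncurry (vertexDigits-injective v w)
    (numeral-injective (vertexLow<M v) (vertexLow<M w)
      (trans (sym (toℕ-label v)) (trans (cong toℕ eq) (toℕ-label w))))

  edgeHigh : OWEdge m n → ℕ
  edgeHigh (spoke j)  = toℕ j
  edgeHigh (cyc i j)  = (1 + 2 * toℕ j) % n
  edgeHigh (rung i j) = (2 * toℕ j) % n

  edgeLow : OWEdge m n → ℕ
  edgeLow (spoke j)  = 2 * k
  edgeLow (cyc i j)  = 2 * toℕ i
  edgeLow (rung i j) = 1 + 2 * toℕ i

  2i<2k : (i : Fin k) → 2 * toℕ i < 2 * k
  2i<2k i = *-monoʳ-< 2 (toℕ<n i)

  edgeLow<M : ∀ e → edgeLow e < M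
  edgeLow<M (spoke j)  = n<1+n (2 * k)
  edgeLow<M (cyc i j)  = m<n⇒m<1+n (2i<2k i)
  edgeLow<M (rung i j) = s≤s (2i<2k i)

  toℕ-label+ₘlabel : ∀ v w {a r} → (vertexHigh v + vertexHigh w) % n ≡ a →
                     vertexLow v + vertexLow w ≡ r → r < M → toℕ (label v +ₘ label w) ≡ a * M + r
  toℕ-label+ₘlabel v w {a} {r} high≡ low≡ r<M = begin
    toℕ (label v +ₘ label w)                        ≡⟨ toℕ-fromℕ< _ ⟩
    (toℕ (label v) + toℕ (label w)) % q             ≡⟨ %-congˡ (cong₂ _+_ (toℕ-label v) (toℕ-label w)) ⟩
    ((hv * M + lv) + (hw * M + lw)) % q             ≡⟨ %-congˡ (numeral-+ hv lv hw lw) ⟩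
    ((hv + hw) * M + (lv + lw)) % q                 ≡⟨ numeral-% (hv + hw) n (subst (_< M) (sym low≡) r<M) ⟩
    (hv + hw) % n * M + (lv + lw)                   ≡⟨ cong₂ (λ x y → x * M + y) high≡ low≡ ⟩
    a * M + r                                       ∎
    where
    open ≡-Reasoning
    hv = vertexHigh v
    hw = vertexHigh w
    lv = vertexLow v
    lw = vertexLow w

  toℕ-edgeLabel : ∀ e → toℕ (edgeLabel (OW m n) label e) ≡ edgeHigh e * M + edgeLow e
  toℕ-edgeLabel e@(spoke j) =
    toℕ-label+ₘlabel nothing (just (fzero , j)) (m<n⇒m%n≡m (toℕ<n j)) (+-identityʳ (2 * k)) (edgeLow<M e)
  toℕ-edgeLabel e@(cyc i j) =
    toℕ-label+ₘlabel (just (inject₁ i , j)) (just (inject₁ i , csuc j)) (toℕ+toℕ-csuc j)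
      (trans (cong (λ x → x + x) (toℕ-inject₁ i)) (m+m≡2*m (toℕ i))) (edgeLow<M e)
  toℕ-edgeLabel e@(rung i j) =
    toℕ-label+ₘlabel (just (inject₁ i , j)) (just (fsuc i , j)) (%-congˡ (m+m≡2*m (toℕ j)))
      (trans (cong (_+ suc (toℕ i)) (toℕ-inject₁ i)) (m+1+m≡1+2*m (toℕ i))) (edgeLow<M e)

  edgeDigits-injective : ∀ e e' → edgeHigh e ≡ edgeHigh e' → edgeLow e ≡ edgeLow e' → e ≡ e'
  edgeDigits-injective (spoke j)  (spoke j')   hi _  = cong spoke (toℕ-injective hi)
  edgeDigits-injective (spoke j)  (cyc i' j')  _  lo = contradiction (sym lo) (<⇒≢ (2i<2k i'))
  edgeDigits-injective (spoke j)  (rung i' j') _  lo = contradiction lo (even≢odd k (toℕ i'))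
  edgeDigits-injective (cyc i j)  (spoke j')   _  lo = contradiction lo (<⇒≢ (2i<2k i))
  edgeDigits-injective (cyc i j)  (cyc i' j')  hi lo =
    cong₂ cyc (toℕ-injective (*-cancelˡ-≡ _ _ 2 lo)) (doubling-injective (s≤s z≤n) j j' hi)
  edgeDigits-injective (cyc i j)  (rung i' j') _  lo = contradiction lo (even≢odd (toℕ i) (toℕ i'))
  edgeDigits-injective (rung i j) (spoke j')   _  lo = contradiction (sym lo) (even≢odd k (toℕ i))
  edgeDigits-injective (rung i j) (cyc i' j')  _  lo = contradiction (sym lo) (even≢odd (toℕ i') (toℕ i))
  edgeDigits-injective (rung i j) (rung i' j') hi lo =
    cong₂ rung (toℕ-injective (*-cancelˡ-≡ _ _ 2 (suc-injective lo))) (doubling-injective z≤n j j' hi)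

  data LowDigit : ℕ → Set where
    spokeDigit : LowDigit (2 * k)
    cycDigit   : (i : Fin k) → LowDigit (2 * toℕ i)
    rungDigit  : (i : Fin k) → LowDigit (1 + 2 * toℕ i)

  lowDigit : ∀ {r} → r < M → LowDigit r
  lowDigit {r} r<M with r ≟ 2 * k
  ... | yes refl = spokeDigit
  ... | no r≢2k  = belowSpoke (≤∧≢⇒< (s≤s⁻¹ r<M) r≢2k)
    where
    belowSpoke : ∀ {r} → r < 2 * k → LowDigit r
    belowSpoke {r} r<2k with even⊎odd r
    ... | inj₁ (t , refl) = subst (λ x → LowDigit (2 * x)) (toℕ-fromℕ< t<k) (cycDigit (fromℕ< t<k))
      where t<k = *-cancelˡ-< 2 t k r<2k
    ... | inj₂ (t , refl) = subst (λ x → LowDigit (1 + 2 * x)) (toℕ-fromℕ< t<k) (rungDigit (fromℕ< t<k))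
      where t<k = *-cancelˡ-< 2 t k (<-trans (n<1+n (2 * t)) r<2k)

  edgeWithDigits : ∀ {a r} → a < n → LowDigit r → Σ (OWEdge m n) λ e → edgeHigh e ≡ a × edgeLow e ≡ r
  edgeWithDigits a<n spokeDigit = spoke (fromℕ< a<n) , toℕ-fromℕ< a<n , refl
  edgeWithDigits a<n (cycDigit i) with doubling-surjective (s≤s z≤n) a<n
  ... | j , high≡a = cyc i j , high≡a , refl
  edgeWithDigits a<n (rungDigit i) with doubling-surjective z≤n a<n
  ... | j , high≡a = rung i j , high≡a , refl

  edgeLabel-injective : Injective _≡_ _≡_ (edgeLabel (OW m n) label)
  edgeLabel-injective {e} {e'} eq = uncurry (edgeDigits-injective e e')
    (numeral-injective (edgeLow<M e) (edgeLow<M e')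
      (trans (sym (toℕ-edgeLabel e)) (trans (cong toℕ eq) (toℕ-edgeLabel e'))))

  toℕ/M<n : (y : Fin q) → toℕ y / M < n
  toℕ/M<n y = m<n*o⇒m/o<n (subst (toℕ y <_) (*-comm M n) (toℕ<n y))

  edgeLabel-surjective : Surjective _≡_ _≡_ (edgeLabel (OW m n) label)
  edgeLabel-surjective y with edgeWithDigits (toℕ/M<n y) (lowDigit (m%n<n (toℕ y) M))
  ... | e , high≡ , low≡ = e , λ { refl → toℕ-injective (begin
    toℕ (edgeLabel (OW m n) label e) ≡⟨ toℕ-edgeLabel e ⟩
    edgeHigh e * M + edgeLow e       ≡⟨ cong₂ (λ a r → a * M + r) high≡ low≡ ⟩
    toℕ y / M * M + toℕ y % M        ≡⟨ +-comm (toℕ y / M * M) (toℕ y % M) ⟩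
    toℕ y % M + toℕ y / M * M        ≡⟨ m≡m%n+[m/n]*n (toℕ y) M ⟨
    toℕ y                            ∎) }
    where open ≡-Reasoning

  harmonious : Harmonious (OW m n) q
  harmonious = label , label-injective , edgeLabel-injective , edgeLabel-surjective

-- The construction also works for n = 1.
corollary8p10 : ∀ (m n : ℕ) → 3 ≤ n → (∃ λ k → n ≡ 2 * k + 1) → 2 ≤ m →
                  Harmonious (OW m n) ((2 * m ∸ 1) * n)
corollary8p10 (suc (suc k)) .(2 * h + 1) _ (h , refl) (s≤s (s≤s _))
  = subst₂ (λ M n → Harmonious (OW (suc (suc k)) n) (M * n))
      (sym (cong (_∸ 1) (*-suc 2 (suc k)))) (+-comm 1 (2 * h)) (OpenWebLabelling.harmonious (suc k) h)
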